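{- (1) In the system $\mathsf{CK}$, every instance of the schemes $((\phi\mathbin{\Diamond\!\!\to}\psi)\wedge(\phi\mathbin{\Box\!\!\to}\chi))\to(\phi\mathbin{\Diamond\!\!\to}(\psi\wedge\chi))$, $(\phi\mathbin{\Diamond\!\!\to}(\psi\vee\chi))\leftrightarrow((\phi\mathbin{\Diamond\!\!\to}\psi)\vee(\phi\mathbin{\Diamond\!\!\to}\chi))$, $((\phi\mathbin{\Diamond\!\!\to}\psi)\to(\phi\mathbin{\Box\!\!\to}\chi))\to(\phi\mathbin{\Box\!\!\to}(\psi\to\chi))$ and $\neg(\phi\mathbin{\Diamond\!\!\to}\bot)$ is provable; the rules "from $\phi\leftrightarrow\psi$ infer $(\phi\mathbin{\Diamond\!\!\to}\chi)\leftrightarrow(\psi\mathbin{\Diamond\!\!\to}\chi)$" and "from $\phi\leftrightarrow\psi$ infer $(\chi\mathbin{\Diamond\!\!\to}\phi)\leftrightarrow(\chi\mathbin{\Diamond\!\!\to}\psi)$" are derivable; the rules "from $\phi$ infer $\psi\mathbin{\Box\!\!\to}\phi$", "from $\phi\to\psi$ infer $(\chi\mathbin{\Box\!\!\to}\phi)\to(\chi\mathbin{\Box\!\!\to}\psi)$", "from $\phi\to\psi$ infer $(\chi\mathbin{\Diamond\!\!\to}\phi)\to(\chi\mathbin{\Diamond\!\!\to}\psi)$" are derivable; and the formulas $(\phi\mathbin{\Box\!\!\to}(\psi\to\chi))\to((\phi\mathbin{\Box\!\!\to}\psi)\to(\phi\mathbin{\Box\!\!\to}\chi))$, $(\phi\mathbin{\Box\!\!\to}(\psi\to\chi))\to((\phi\mathbin{\Diamond\!\!\to}\psi)\to(\phi\mathbin{\Diamond\!\!\to}\chi))$,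 $(\phi\mathbin{\Box\!\!\to}\psi)\to((\phi\mathbin{\Diamond\!\!\to}(\psi\to\chi))\to(\phi\mathbin{\Diamond\!\!\to}\chi))$, $\neg(\phi\mathbin{\Diamond\!\!\to}\psi)\leftrightarrow(\phi\mathbin{\Box\!\!\to}\neg\psi)$ are provable. (2) Every instance of $(\phi\mathbin{\Diamond\!\!\to}\psi)\leftrightarrow\neg(\phi\mathbin{\Box\!\!\to}\neg\psi)$ is provable in $\mathsf{IntCK}+(\mathrm{Ax0})$.
   Context: $\mathcal{L}$ is built from propositional variables and $\top,\bot$ by $\wedge,\vee,\to$ and connectives $\phi\mathbin{\Box\!\!\to}\psi$, $\phi\mathbin{\Diamond\!\!\to}\psi$; $\neg\phi:=\phi\to\bot$. $\mathsf{CK}$ is the Hilbert system with axioms: (A0) all $\mathcal{L}$-instances of a complete axiomatization of intuitionistic propositional logic; (A1) $((\phi\mathbin{\Box\!\!\to}\psi)\wedge(\phi\mathbin{\Box\!\!\to}\chi))\leftrightarrow(\phi\mathbin{\Box\!\!\to}(\psi\wedge\chi))$; (A5) $\phi\mathbin{\Box\!\!\to}\top$; (Ax0) $\phi\vee\neg\phi$; (Ax1) $(\phi\mathbin{\Diamond\!\!\to}\psi)\leftrightarrow\neg(\phi\mathbin{\Box\!\!\to}\neg\psi)$; rules: modus ponens, from $\phi\leftrightarrow\psi$ infer $(\phi\mathbin{\Box\!\!\to}\chi)\leftrightarrow(\psi\mathbin{\Box\!\!\to}\chi)$, and from $\phi\leftrightarrow\psi$ infer $(\chi\mathbin{\Box\!\!\to}\phi)\leftrightarrow(\chi\mathbin{\Box\!\!\to}\psi)$.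 $\mathsf{IntCK}+(\mathrm{Ax0})$ is the Hilbert system with axioms (A0), (A1), (A5), (Ax0) and also (A2) $((\phi\mathbin{\Diamond\!\!\to}\psi)\wedge(\phi\mathbin{\Box\!\!\to}\chi))\to(\phi\mathbin{\Diamond\!\!\to}(\psi\wedge\chi))$, (A3) $(\phi\mathbin{\Diamond\!\!\to}(\psi\vee\chi))\leftrightarrow((\phi\mathbin{\Diamond\!\!\to}\psi)\vee(\phi\mathbin{\Diamond\!\!\to}\chi))$, (A4) $((\phi\mathbin{\Diamond\!\!\to}\psi)\to(\phi\mathbin{\Box\!\!\to}\chi))\to(\phi\mathbin{\Box\!\!\to}(\psi\to\chi))$, (A6) $\neg(\phi\mathbin{\Diamond\!\!\to}\bot)$, with rules modus ponens, the two $\mathbin{\Box\!\!\to}$-rules above and the same two with $\mathbin{\Diamond\!\!\to}$. A rule "from $\alpha$ infer $\beta$" is derivable in a system iff there is a finite sequence ending in $\beta$ each member of which is $\alpha$, a theorem, or obtained from earlier members by a rule of the system. -}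

module Defs where

open import Data.Nat using (ℕ)
open import Data.List using (List; []; _∷_)
open import Data.List.Relation.Unary.All using (All)
open import Data.List.Membership.Propositional using (_∈_)
open import Data.Product using (∃)
open import Relation.Binary.PropositionalEquality using (_≡_)

infixr 6 _∧_
infixr 5 _∨_
infixr 4 _⇒_ _□→_ _◇→_
infix  3 _⇔_

data Fm : Set where
  var   : ℕ → Fm
  ⊤' ⊥' : Fm
  _∧_ _∨_ _⇒_ _□→_ _◇→_ : Fm → Fm → Fm

¬' : Fm → Fm
¬' φ = φ ⇒ ⊥'

_⇔_ : Fm → Fm → Fm
φ ⇔ ψ = (φ ⇒ ψ) ∧ (ψ ⇒ φ)

-- (A0): all 𝓛-instances of a fixed complete Hilbert axiomatization of
-- intuitionistic propositional logic (with ⊤).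
data IPC : Fm → Set where
  K    : ∀ φ ψ → IPC (φ ⇒ (ψ ⇒ φ))
  S    : ∀ φ ψ χ → IPC ((φ ⇒ (ψ ⇒ χ)) ⇒ ((φ ⇒ ψ) ⇒ (φ ⇒ χ)))
  ∧E₁  : ∀ φ ψ → IPC (φ ∧ ψ ⇒ φ)
  ∧E₂  : ∀ φ ψ → IPC (φ ∧ ψ ⇒ ψ)
  ∧I   : ∀ φ ψ → IPC (φ ⇒ (ψ ⇒ φ ∧ ψ))
  ∨I₁  : ∀ φ ψ → IPC (φ ⇒ φ ∨ ψ)
  ∨I₂  : ∀ φ ψ → IPC (ψ ⇒ φ ∨ ψ)
  ∨E   : ∀ φ ψ χ → IPC ((φ ⇒ χ) ⇒ ((ψ ⇒ χ) ⇒ (φ ∨ ψ ⇒ χ)))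
  efq  : ∀ φ → IPC (⊥' ⇒ φ)
  top  : IPC ⊤'

record System : Set₁ where
  field
    Axiom : Fm → Set
    Rule  : List Fm → Fm → Set
open System public

data _⊢_ (𝒮 : System) : Fm → Set where
  ax   : ∀ {φ} → Axiom 𝒮 φ → 𝒮 ⊢ φ
  rule : ∀ {ps φ} → Rule 𝒮 ps φ → All (𝒮 ⊢_) ps → 𝒮 ⊢ φ

data CKAx : Fm → Set where
  A0  : ∀ {φ} → IPC φ → CKAx φ
  A1  : ∀ φ ψ χ → CKAx (((φ □→ ψ) ∧ (φ □→ χ)) ⇔ (φ □→ (ψ ∧ χ)))
  A5  : ∀ φ → CKAx (φ □→ ⊤')
  Ax0 : ∀ φ → CKAx (φ ∨ ¬' φ)
  Ax1 : ∀ φ ψ → CKAx ((φ ◇→ ψ) ⇔ ¬' (φ □→ ¬' ψ))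

data CKRule : List Fm → Fm → Set where
  MP   : ∀ φ ψ → CKRule (φ ∷ (φ ⇒ ψ) ∷ []) ψ
  □L   : ∀ φ ψ χ → CKRule ((φ ⇔ ψ) ∷ []) ((φ □→ χ) ⇔ (ψ □→ χ))
  □R   : ∀ φ ψ χ → CKRule ((φ ⇔ ψ) ∷ []) ((χ □→ φ) ⇔ (χ □→ ψ))

CK : System
CK = record { Axiom = CKAx ; Rule = CKRule }

data IntAx : Fm → Set where
  A0  : ∀ {φ} → IPC φ → IntAx φ
  A1  : ∀ φ ψ χ → IntAx (((φ □→ ψ) ∧ (φ □→ χ)) ⇔ (φ □→ (ψ ∧ χ)))
  A2  : ∀ φ ψ χ → IntAx (((φ ◇→ ψ) ∧ (φ □→ χ)) ⇒ (φ ◇→ (ψ ∧ χ)))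
  A3  : ∀ φ ψ χ → IntAx ((φ ◇→ (ψ ∨ χ)) ⇔ ((φ ◇→ ψ) ∨ (φ ◇→ χ)))
  A4  : ∀ φ ψ χ → IntAx (((φ ◇→ ψ) ⇒ (φ □→ χ)) ⇒ (φ □→ (ψ ⇒ χ)))
  A5  : ∀ φ → IntAx (φ □→ ⊤')
  A6  : ∀ φ → IntAx (¬' (φ ◇→ ⊥'))
  Ax0 : ∀ φ → IntAx (φ ∨ ¬' φ)

data IntRule : List Fm → Fm → Set where
  MP   : ∀ φ ψ → IntRule (φ ∷ (φ ⇒ ψ) ∷ []) ψ
  □L   : ∀ φ ψ χ → IntRule ((φ ⇔ ψ) ∷ []) ((φ □→ χ) ⇔ (ψ □→ χ))
  □R   : ∀ φ ψ χ → IntRule ((φ ⇔ ψ) ∷ []) ((χ □→ φ) ⇔ (χ □→ ψ))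
  ◇L   : ∀ φ ψ χ → IntRule ((φ ⇔ ψ) ∷ []) ((φ ◇→ χ) ⇔ (ψ ◇→ χ))
  ◇R   : ∀ φ ψ χ → IntRule ((φ ⇔ ψ) ∷ []) ((χ ◇→ φ) ⇔ (χ ◇→ ψ))

IntCK+Ax0 : System
IntCK+Ax0 = record { Axiom = IntAx ; Rule = IntRule }

-- Derivable rules, literally as finite sequences.  A sequence is kept
-- as a list with its LAST member at the head; 'DSeq 𝒮 α Γ' says every
-- member of Γ is α, a theorem of 𝒮, or obtained from earlier members
-- by a rule of 𝒮.
data Justified (𝒮 : System) (α : Fm) (Γ : List Fm) : Fm → Set where
  hyp  : Justified 𝒮 α Γ α
  thm  : ∀ {φ} → 𝒮 ⊢ φ → Justified 𝒮 α Γ φ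
  rule : ∀ {ps φ} → Rule 𝒮 ps φ → All (_∈ Γ) ps → Justified 𝒮 α Γ φ

data DSeq (𝒮 : System) (α : Fm) : List Fm → Set where
  []  : DSeq 𝒮 α []
  _∷_ : ∀ {φ Γ} → Justified 𝒮 α Γ φ → DSeq 𝒮 α Γ → DSeq 𝒮 α (φ ∷ Γ)

Derivable : System → Fm → Fm → Set
Derivable 𝒮 α β = ∃ λ Γ → DSeq 𝒮 α (β ∷ Γ)

{-# OPTIONS --safe #-}
-- In CK, (Ax1) turns each ◇→-scheme into a statement about □→ with a negated
-- consequent; these follow from the monotonicity rule for □→ (obtained from (A1)
-- and the congruence rule) and excluded middle.  In IntCK+(Ax0), (A2) with χ = ¬ψ and (A6) give ◇→ ⇒ ¬□→¬,
-- and (A4) with χ = ⊥ together with excluded middle on φ ◇→ ψ gives the converse.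
module Submission where

open import Defs
open import Data.Product using (_×_; _,_)
open import Data.List using ([]; _∷_; _++_)
open import Data.List.Relation.Unary.All as All using (All; []; _∷_)
open import Data.List.Relation.Unary.Any using (here)
open import Data.List.Membership.Propositional.Properties using (∈-++⁺ˡ; ∈-++⁺ʳ)
open import Relation.Binary.PropositionalEquality using (refl)

module NaturalDeduction (𝒮 : System)
  (ipc : ∀ {φ} → IPC φ → 𝒮 ⊢ φ)
  (mp-rule : ∀ φ ψ → Rule 𝒮 (φ ∷ (φ ⇒ ψ) ∷ []) ψ) where

  infixl 9 _·_

  mp : ∀ {φ ψ} → 𝒮 ⊢ φ → 𝒮 ⊢ (φ ⇒ ψ) → 𝒮 ⊢ ψ
  mp p q = rule (mp-rule _ _) (p ∷ q ∷ [])

  -- A context is a left-nested conjunction (⊤' ∧ φ₁) ∧ … ∧ φₙ, and #0, #1, #2 are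
  -- de Bruijn indices into it.
  _⊩_ : Fm → Fm → Set
  Γ ⊩ φ = 𝒮 ⊢ (Γ ⇒ φ)

  lift : ∀ {Γ φ} → 𝒮 ⊢ φ → Γ ⊩ φ
  lift {Γ} {φ} p = mp p (ipc (K φ Γ))

  _·_ : ∀ {Γ φ ψ} → Γ ⊩ (φ ⇒ ψ) → Γ ⊩ φ → Γ ⊩ ψ
  _·_ {Γ} {φ} {ψ} f x = mp x (mp f (ipc (S Γ φ ψ)))

  close : ∀ {φ} → ⊤' ⊩ φ → 𝒮 ⊢ φ
  close t = mp (ipc top) t

  ⊩-trans : ∀ {Γ Δ φ} → 𝒮 ⊢ (Γ ⇒ Δ) → Δ ⊩ φ → Γ ⊩ φ
  ⊩-trans f g = lift g · f

  lam : ∀ {Γ φ ψ} → (Γ ∧ φ) ⊩ ψ → Γ ⊩ (φ ⇒ ψ)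
  lam {Γ} {φ} {ψ} h = ⊩-trans (ipc (∧I Γ φ)) (mp (lift h) (ipc (S φ (Γ ∧ φ) ψ)))

  weaken : ∀ {Γ φ ψ} → Γ ⊩ ψ → (Γ ∧ φ) ⊩ ψ
  weaken {Γ} {φ} t = ⊩-trans (ipc (∧E₁ Γ φ)) t

  #0 : ∀ {Γ φ} → (Γ ∧ φ) ⊩ φ
  #0 {Γ} {φ} = ipc (∧E₂ Γ φ)

  #1 : ∀ {Γ φ ψ} → ((Γ ∧ φ) ∧ ψ) ⊩ φ
  #1 = weaken #0

  #2 : ∀ {Γ φ ψ χ} → (((Γ ∧ φ) ∧ ψ) ∧ χ) ⊩ φ
  #2 = weaken #1

  ⟨_,_⟩ : ∀ {Γ φ ψ} → Γ ⊩ φ → Γ ⊩ ψ → Γ ⊩ (φ ∧ ψ)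
  ⟨ x , y ⟩ = lift (ipc (∧I _ _)) · x · y

  fst : ∀ {Γ φ ψ} → Γ ⊩ (φ ∧ ψ) → Γ ⊩ φ
  fst x = lift (ipc (∧E₁ _ _)) · x

  snd : ∀ {Γ φ ψ} → Γ ⊩ (φ ∧ ψ) → Γ ⊩ ψ
  snd x = lift (ipc (∧E₂ _ _)) · x

  inl : ∀ {Γ φ ψ} → Γ ⊩ φ → Γ ⊩ (φ ∨ ψ)
  inl x = lift (ipc (∨I₁ _ _)) · x

  inr : ∀ {Γ φ ψ} → Γ ⊩ ψ → Γ ⊩ (φ ∨ ψ)
  inr x = lift (ipc (∨I₂ _ _)) · x

  case : ∀ {Γ φ ψ χ} → Γ ⊩ (φ ∨ ψ) → Γ ⊩ (φ ⇒ χ) → Γ ⊩ (ψ ⇒ χ) → Γ ⊩ χ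
  case x f g = lift (ipc (∨E _ _ _)) · f · g · x

  absurd : ∀ {Γ φ} → Γ ⊩ ⊥' → Γ ⊩ φ
  absurd x = lift (ipc (efq _)) · x

  ⇔-to : ∀ {φ ψ} → 𝒮 ⊢ (φ ⇔ ψ) → 𝒮 ⊢ (φ ⇒ ψ)
  ⇔-to p = mp p (ipc (∧E₁ _ _))

  ⇔-from : ∀ {φ ψ} → 𝒮 ⊢ (φ ⇔ ψ) → 𝒮 ⊢ (ψ ⇒ φ)
  ⇔-from p = mp p (ipc (∧E₂ _ _))

  ⇔-cong-¬ : ∀ {φ ψ χ ω} → 𝒮 ⊢ (φ ⇔ ¬' χ) → 𝒮 ⊢ (ψ ⇔ ¬' ω) →
             𝒮 ⊢ ((χ ⇔ ω) ⇒ (φ ⇔ ψ))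
  ⇔-cong-¬ φ≡¬χ ψ≡¬ω = close (lam ⟨
    lam (lift (⇔-from ψ≡¬ω) · lam (lift (⇔-to φ≡¬χ) · #1 · (snd #2 · #0))) ,
    lam (lift (⇔-from φ≡¬χ) · lam (lift (⇔-to ψ≡¬ω) · #1 · (fst #2 · #0))) ⟩)

  module Classical (em : ∀ φ → 𝒮 ⊢ (φ ∨ ¬' φ)) where

    by-cases : ∀ {Γ χ} φ → Γ ⊩ (φ ⇒ χ) → Γ ⊩ (¬' φ ⇒ χ) → Γ ⊩ χ
    by-cases φ = case (lift (em φ))

    ¬¬-elim : ∀ {Γ φ} → Γ ⊩ (¬' (¬' φ) ⇒ φ)
    ¬¬-elim {φ = φ} = lam (by-cases φ (lam #0) (lam (absurd (#1 · #0))))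

  hypothesis : ∀ {α} → Derivable 𝒮 α α
  hypothesis = [] , (hyp ∷ [])

  theorem : ∀ {α β} → 𝒮 ⊢ β → Derivable 𝒮 α β
  theorem p = [] , (thm p ∷ [])

  apply-rule¹ : ∀ {α φ ψ} → Rule 𝒮 (φ ∷ []) ψ → Derivable 𝒮 α φ → Derivable 𝒮 α ψ
  apply-rule¹ {φ = φ} r (Γ , s) = (φ ∷ Γ) , (rule r (here refl ∷ []) ∷ s)

  private
    Justified-++ : ∀ {α Γ Δ φ} → Justified 𝒮 α Γ φ → Justified 𝒮 α (Γ ++ Δ) φ
    Justified-++ hyp = hyp
    Justified-++ (thm p) = thm p
    Justified-++ (rule r ps) = rule r (All.map ∈-++⁺ˡ ps)

    DSeq-++ : ∀ {α Γ Δ} → DSeq 𝒮 α Γ → DSeq 𝒮 α Δ → DSeq 𝒮 α (Γ ++ Δ)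
    DSeq-++ [] t = t
    DSeq-++ (j ∷ s) t = Justified-++ j ∷ DSeq-++ s t

  apply-mp : ∀ {α φ ψ} → Derivable 𝒮 α φ → Derivable 𝒮 α (φ ⇒ ψ) → Derivable 𝒮 α ψ
  apply-mp {φ = φ} {ψ} (Γ , s) (Δ , t) =
    ((φ ∷ Γ) ++ ((φ ⇒ ψ) ∷ Δ)) ,
    (rule (mp-rule φ ψ) (∈-++⁺ˡ {xs = φ ∷ Γ} (here refl) ∷ ∈-++⁺ʳ (φ ∷ Γ) (here refl) ∷ [])
      ∷ DSeq-++ s t)

  DSeq-sound : ∀ {α Γ} → 𝒮 ⊢ α → DSeq 𝒮 α Γ → All (𝒮 ⊢_) Γ
  DSeq-sound ⊢α [] = []
  DSeq-sound ⊢α (j ∷ s) = Justified-sound j ∷ ⊢Γ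
    where
    ⊢Γ = DSeq-sound ⊢α s
    Justified-sound : ∀ {φ} → Justified 𝒮 _ _ φ → 𝒮 ⊢ φ
    Justified-sound hyp = ⊢α
    Justified-sound (thm p) = p
    Justified-sound (rule r ps) = rule r (All.map (All.lookup ⊢Γ) ps)

  derivable⇒admissible : ∀ {α β} → Derivable 𝒮 α β → 𝒮 ⊢ α → 𝒮 ⊢ β
  derivable⇒admissible (Γ , s) ⊢α with DSeq-sound ⊢α s
  ... | ⊢β ∷ _ = ⊢β

module IntCK+Ax0-Reasoning = NaturalDeduction IntCK+Ax0 (λ p → ax (A0 p)) MP

module _ where
  open IntCK+Ax0-Reasoning
  open Classical (λ φ → ax (Ax0 φ))

  ◇⇔¬□¬-IntCK+Ax0 : ∀ φ ψ → IntCK+Ax0 ⊢ ((φ ◇→ ψ) ⇔ ¬' (φ □→ ¬' ψ))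
  ◇⇔¬□¬-IntCK+Ax0 φ ψ = close ⟨
      lam (lam (lift (ax (A6 φ)) ·
        (lift (⇔-to ◇-contradiction) · (lift (ax (A2 φ ψ (¬' ψ))) · ⟨ #1 , #0 ⟩)))) ,
      lam (by-cases (φ ◇→ ψ) (lam #0)
        (lam (absurd (#1 · (lift (ax (A4 φ ψ ⊥')) · lam (absurd (#1 · #0))))))) ⟩
    where
    ◇-contradiction : IntCK+Ax0 ⊢ ((φ ◇→ (ψ ∧ ¬' ψ)) ⇔ (φ ◇→ ⊥'))
    ◇-contradiction = rule (◇R (ψ ∧ ¬' ψ) ⊥' φ)
      (close ⟨ lam (snd #0 · fst #0) , lam (absurd #0) ⟩ ∷ [])

module CK-Reasoning = NaturalDeduction CK (λ p → ax (A0 p)) MP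

module _ where
  open CK-Reasoning
  open Classical (λ φ → ax (Ax0 φ))

  ◇⇒¬□¬ : ∀ φ ψ → CK ⊢ ((φ ◇→ ψ) ⇒ ¬' (φ □→ ¬' ψ))
  ◇⇒¬□¬ φ ψ = ⇔-to (ax (Ax1 φ ψ))

  ¬□¬⇒◇ : ∀ φ ψ → CK ⊢ (¬' (φ □→ ¬' ψ) ⇒ (φ ◇→ ψ))
  ¬□¬⇒◇ φ ψ = ⇔-from (ax (Ax1 φ ψ))

  □-∧-merge : ∀ φ ψ χ → CK ⊢ (((φ □→ ψ) ∧ (φ □→ χ)) ⇒ (φ □→ (ψ ∧ χ)))
  □-∧-merge φ ψ χ = ⇔-to (ax (A1 φ ψ χ))

  □-∧-split : ∀ φ ψ χ → CK ⊢ ((φ □→ (ψ ∧ χ)) ⇒ ((φ □→ ψ) ∧ (φ □→ χ)))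
  □-∧-split φ ψ χ = ⇔-from (ax (A1 φ ψ χ))

  -- ψ ⇒ χ makes ψ equivalent to ψ ∧ χ, so the congruence rule applies.
  □-mono-derivable : ∀ {α} φ ψ χ → Derivable CK α (ψ ⇒ χ) →
                     Derivable CK α ((φ □→ ψ) ⇒ (φ □→ χ))
  □-mono-derivable φ ψ χ ψ⇒χ =
    apply-mp (apply-rule¹ (□R ψ (ψ ∧ χ) φ) (apply-mp ψ⇒χ (theorem ⇒-as-⇔-∧)))
             (theorem (close (lam (lam (snd (lift (□-∧-split φ ψ χ) · (fst #1 · #0)))))))
    where
    ⇒-as-⇔-∧ : CK ⊢ ((ψ ⇒ χ) ⇒ (ψ ⇔ (ψ ∧ χ)))
    ⇒-as-⇔-∧ = close (lam ⟨ lam ⟨ #0 , #1 · #0 ⟩ , lam (fst #0) ⟩)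

  □-mono : ∀ {ψ χ} φ → CK ⊢ (ψ ⇒ χ) → CK ⊢ ((φ □→ ψ) ⇒ (φ □→ χ))
  □-mono {ψ} {χ} φ = derivable⇒admissible (□-mono-derivable φ ψ χ hypothesis)

  ◇-mono-derivable : ∀ {α} φ ψ χ → Derivable CK α (ψ ⇒ χ) →
                     Derivable CK α ((φ ◇→ ψ) ⇒ (φ ◇→ χ))
  ◇-mono-derivable φ ψ χ ψ⇒χ =
    apply-mp (□-mono-derivable φ (¬' χ) (¬' ψ) (apply-mp ψ⇒χ (theorem contraposition)))
             (theorem (close (lam (lam (lift (¬□¬⇒◇ φ χ) ·
               lam (lift (◇⇒¬□¬ φ ψ) · #1 · (#2 · #0)))))))
    where
    contraposition : CK ⊢ ((ψ ⇒ χ) ⇒ (¬' χ ⇒ ¬' ψ))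
    contraposition = close (lam (lam (lam (#1 · (#2 · #0)))))

  ◇-mono : ∀ {ψ χ} φ → CK ⊢ (ψ ⇒ χ) → CK ⊢ ((φ ◇→ ψ) ⇒ (φ ◇→ χ))
  ◇-mono {ψ} {χ} φ = derivable⇒admissible (◇-mono-derivable φ ψ χ hypothesis)

  ¬◇⇔□¬ : ∀ φ ψ → CK ⊢ (¬' (φ ◇→ ψ) ⇔ (φ □→ ¬' ψ))
  ¬◇⇔□¬ φ ψ = close ⟨
    lam (¬¬-elim · lam (#1 · (lift (¬□¬⇒◇ φ ψ) · #0))) ,
    lam (lam (lift (◇⇒¬□¬ φ ψ) · #0 · #1)) ⟩

  -- If ρ ∧ ¬χ refutes ψ, then □ρ and ¬◇χ, i.e. □¬χ, give □¬ψ, refuting ◇ψ.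
  □-◇-combine : ∀ {ρ ψ χ} φ → CK ⊢ ((ρ ∧ ¬' χ) ⇒ ¬' ψ) →
                CK ⊢ ((φ □→ ρ) ⇒ ((φ ◇→ ψ) ⇒ (φ ◇→ χ)))
  □-◇-combine {ρ} {ψ} {χ} φ refutes = close (lam (lam (lift (¬□¬⇒◇ φ χ) · lam
    (lift (◇⇒¬□¬ φ ψ) · #1 ·
      (lift (□-mono φ refutes) · (lift (□-∧-merge φ ρ (¬' χ)) · ⟨ #2 , #0 ⟩))))))

  ◇-∧-□ : ∀ φ ψ χ → CK ⊢ (((φ ◇→ ψ) ∧ (φ □→ χ)) ⇒ (φ ◇→ (ψ ∧ χ)))
  ◇-∧-□ φ ψ χ = close (lam (lift (□-◇-combine φ refutes) · snd #0 · fst #0))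
    where
    refutes : CK ⊢ ((χ ∧ ¬' (ψ ∧ χ)) ⇒ ¬' ψ)
    refutes = close (lam (lam (snd #1 · ⟨ #0 , fst #1 ⟩)))

  ¬◇⊥ : ∀ φ → CK ⊢ ¬' (φ ◇→ ⊥')
  ¬◇⊥ φ = close (lam (lift (◇⇒¬□¬ φ ⊥') · #0 · lift □¬⊥))
    where
    □¬⊥ : CK ⊢ (φ □→ ¬' ⊥')
    □¬⊥ = mp (ax (A5 φ)) (□-mono φ (close (lam (lam #0))))

  ◇-∨-distrib : ∀ φ ψ χ → CK ⊢ ((φ ◇→ (ψ ∨ χ)) ⇔ ((φ ◇→ ψ) ∨ (φ ◇→ χ)))
  ◇-∨-distrib φ ψ χ = close ⟨
    lam (by-cases (φ ◇→ ψ) (lam (inl #0)) (lam (by-cases (φ ◇→ χ) (lam (inr #0))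
      (lam (absurd (lift (¬◇⊥ φ) · (lift (□-◇-combine φ refutes) · □¬ψ∧¬χ · #2))))))) ,
    lam (case #0 (lift (◇-mono φ (ax (A0 (∨I₁ ψ χ)))))
                 (lift (◇-mono φ (ax (A0 (∨I₂ ψ χ)))))) ⟩
    where
    refutes : CK ⊢ (((¬' ψ ∧ ¬' χ) ∧ ¬' ⊥') ⇒ ¬' (ψ ∨ χ))
    refutes = close (lam (lam (case #0 (fst (fst #1)) (snd (fst #1)))))
    □¬ψ∧¬χ : ∀ {Γ} → (((Γ ∧ (φ ◇→ (ψ ∨ χ))) ∧ ¬' (φ ◇→ ψ)) ∧ ¬' (φ ◇→ χ))
                     ⊩ (φ □→ (¬' ψ ∧ ¬' χ))
    □¬ψ∧¬χ = lift (□-∧-merge φ (¬' ψ) (¬' χ)) ·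
      ⟨ lift (⇔-to (¬◇⇔□¬ φ ψ)) · #1 , lift (⇔-to (¬◇⇔□¬ φ χ)) · #0 ⟩

  ◇⇒□⇒□-⇒ : ∀ φ ψ χ → CK ⊢ (((φ ◇→ ψ) ⇒ (φ □→ χ)) ⇒ (φ □→ (ψ ⇒ χ)))
  ◇⇒□⇒□-⇒ φ ψ χ = close (lam (by-cases (φ □→ ¬' ψ)
    (lift (□-mono φ (close (lam (lam (absurd (#1 · #0)))))))
    (lam (lift (□-mono φ (ax (A0 (K χ ψ)))) · (#1 · (lift (¬□¬⇒◇ φ ψ) · #0))))))

  □-K : ∀ φ ψ χ → CK ⊢ ((φ □→ (ψ ⇒ χ)) ⇒ ((φ □→ ψ) ⇒ (φ □→ χ)))
  □-K φ ψ χ = close (lam (lam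
    (lift (□-mono φ (close (lam (fst #0 · snd #0)))) ·
      (lift (□-∧-merge φ (ψ ⇒ χ) ψ) · ⟨ #1 , #0 ⟩))))

  □◇-K : ∀ φ ψ χ → CK ⊢ ((φ □→ (ψ ⇒ χ)) ⇒ ((φ ◇→ ψ) ⇒ (φ ◇→ χ)))
  □◇-K φ ψ χ = □-◇-combine φ (close (lam (lam (snd #1 · (fst #1 · #0)))))

  ◇□-K : ∀ φ ψ χ → CK ⊢ ((φ □→ ψ) ⇒ ((φ ◇→ (ψ ⇒ χ)) ⇒ (φ ◇→ χ)))
  ◇□-K φ ψ χ = □-◇-combine φ (close (lam (lam (snd #1 · (#0 · fst #1)))))

  ◇-congˡ-derivable : ∀ φ ψ χ → Derivable CK (φ ⇔ ψ) ((φ ◇→ χ) ⇔ (ψ ◇→ χ))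
  ◇-congˡ-derivable φ ψ χ =
    apply-mp (apply-rule¹ (□L φ ψ (¬' χ)) hypothesis)
             (theorem (⇔-cong-¬ (ax (Ax1 φ χ)) (ax (Ax1 ψ χ))))

  ◇-congʳ-derivable : ∀ φ ψ χ → Derivable CK (φ ⇔ ψ) ((χ ◇→ φ) ⇔ (χ ◇→ ψ))
  ◇-congʳ-derivable φ ψ χ =
    apply-mp (apply-rule¹ (□R (¬' φ) (¬' ψ) χ)
                          (apply-mp hypothesis (theorem ⇔-cong-¬-self)))
             (theorem (⇔-cong-¬ (ax (Ax1 χ φ)) (ax (Ax1 χ ψ))))
    where
    ⇔-cong-¬-self : CK ⊢ ((φ ⇔ ψ) ⇒ (¬' φ ⇔ ¬' ψ))
    ⇔-cong-¬-self = close (lam ⟨ lam (lam (#1 · (snd #2 · #0))) ,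
                                 lam (lam (#1 · (fst #2 · #0))) ⟩)

  -- A theorem φ is equivalent to ⊤', and ψ □→ ⊤' is (A5).
  □-necessitation-derivable : ∀ φ ψ → Derivable CK φ (ψ □→ φ)
  □-necessitation-derivable φ ψ =
    apply-mp (apply-rule¹ (□R φ ⊤' ψ) (apply-mp hypothesis (theorem ⇔⊤)))
             (theorem (close (lam (snd #0 · lift (ax (A5 ψ))))))
    where
    ⇔⊤ : CK ⊢ (φ ⇒ (φ ⇔ ⊤'))
    ⇔⊤ = close (lam ⟨ lam (lift (ax (A0 top))) , lam #1 ⟩)

lemma12 : ((∀ φ ψ χ →
    (CK ⊢ (((φ ◇→ ψ) ∧ (φ □→ χ)) ⇒ (φ ◇→ (ψ ∧ χ))))
    × (CK ⊢ ((φ ◇→ (ψ ∨ χ)) ⇔ ((φ ◇→ ψ) ∨ (φ ◇→ χ))))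
    × (CK ⊢ (((φ ◇→ ψ) ⇒ (φ □→ χ)) ⇒ (φ □→ (ψ ⇒ χ))))
    × (CK ⊢ ¬' (φ ◇→ ⊥'))
    × Derivable CK (φ ⇔ ψ) ((φ ◇→ χ) ⇔ (ψ ◇→ χ))
    × Derivable CK (φ ⇔ ψ) ((χ ◇→ φ) ⇔ (χ ◇→ ψ))
    × Derivable CK φ (ψ □→ φ)
    × Derivable CK (φ ⇒ ψ) ((χ □→ φ) ⇒ (χ □→ ψ))
    × Derivable CK (φ ⇒ ψ) ((χ ◇→ φ) ⇒ (χ ◇→ ψ))
    × (CK ⊢ ((φ □→ (ψ ⇒ χ)) ⇒ ((φ □→ ψ) ⇒ (φ □→ χ))))
    × (CK ⊢ ((φ □→ (ψ ⇒ χ)) ⇒ ((φ ◇→ ψ) ⇒ (φ ◇→ χ))))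
    × (CK ⊢ ((φ □→ ψ) ⇒ ((φ ◇→ (ψ ⇒ χ)) ⇒ (φ ◇→ χ))))
    × (CK ⊢ (¬' (φ ◇→ ψ) ⇔ (φ □→ ¬' ψ))))
    × (∀ φ ψ → IntCK+Ax0 ⊢ ((φ ◇→ ψ) ⇔ ¬' (φ □→ ¬' ψ))))
lemma12 = (λ φ ψ χ →
      ◇-∧-□ φ ψ χ , ◇-∨-distrib φ ψ χ , ◇⇒□⇒□-⇒ φ ψ χ , ¬◇⊥ φ
    , ◇-congˡ-derivable φ ψ χ , ◇-congʳ-derivable φ ψ χ , □-necessitation-derivable φ ψ
    , □-mono-derivable χ φ ψ CK-Reasoning.hypothesis
    , ◇-mono-derivable χ φ ψ CK-Reasoning.hypothesis
    , □-K φ ψ χ , □◇-K φ ψ χ , ◇□-K φ ψ χ , ¬◇⇔□¬ φ ψ)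
  , ◇⇔¬□¬-IntCK+Ax0
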